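{- For every assignment $\rho$, frame $F$ and term $t$, $G([\![t]\!]_{F,\rho})\le\max(G(\rho),G(F))+\mathrm{lh}(t)$.
   Context: Terms are built from variables and function symbols of a set $\mathcal F$ with arities, containing $\mathcal B=\{\epsilon,\mathrm s_0,\mathrm s_1\}$ ($\epsilon$ constant, $\mathrm s_0,\mathrm s_1$ unary); $\mathrm{lh}(x)=1$ for variables, $\mathrm{lh}(f(t_1,\dots,t_n))=\mathrm{lh}(t_1)+\dots+\mathrm{lh}(t_n)+1$. $\mathbb D$ is generated by $v::=\epsilon\mid v0\mid v1\mid *$, with $\mathrm s_i(v)=vi$; gauge $G(\epsilon)=G(*)=1$, $G(v0)=G(v1)=G(v)+1$, and the gauge of a tuple is the maximum of the gauges of its components. The order $\sqsubseteq$ on $\mathbb D$ is the smallest relation with $*\sqsubseteq v$, $\epsilon\sqsubseteq\epsilon$, and $v\sqsubseteq w\Rightarrow v0\sqsubseteq w0,\ v1\sqsubseteq w1$, extended componentwise to tuples; tuples are compatible if componentwise comparable; $\max_\sqsubseteq(S)$ is the greatest element of a finite pairwise compatible $S$, $*$ for $S=\emptyset$. A generator is $\vec u\mapsto v$ with $v\ne*$; a consistent set is a finite set $\hat f$ of generators such that compatible arguments give compatible values; it defines $\hat f(\vec x)=\max_\sqsubseteq\{v\mid\exists\vec w\sqsubseteq\vec x,\ \vec w\mapsto v\in\hat f\}$; its gauge is $\max\{G(\vec v),G(w)\mid\vec v\mapsto w\in\hat f\}$. A frame $F$ is a finite partial map from $\mathcal F\setminus\mathcal B$ to consistent sets, with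 $F(f)=\emptyset$ outside its domain; $F(f)(\vec v)=f(\vec v)$ for $f\in\mathcal B$ and $F(f)(\vec v)=\hat f(\vec v)$, $\hat f=F(f)$, otherwise; $G(F)$ is the maximum of the gauges of $F(f)$, $f\in\mathrm{dom}(F)$. An assignment $\rho$ is a finite partial map from variables to $\mathbb D$ with $\rho(x)=*$ outside its domain; $G(\rho)=\max\{G(v)\mid v\in\mathrm{rng}(\rho)\}$. Maxima of empty sets of numbers are $0$. Evaluation: $[\![x]\!]_{F,\rho}=\rho(x)$, $[\![f(t_1,\dots,t_n)]\!]_{F,\rho}=F(f)([\![t_1]\!]_{F,\rho},\dots,[\![t_n]\!]_{F,\rho})$. -}

module Defs where

open import Data.Nat using (ℕ; zero; suc; _+_; _⊔_)
open import Data.List using (List; []; _∷_; foldr; map; filter)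
open import Data.List.Membership.Propositional using (_∈_)
open import Data.List.Relation.Unary.All using (All)
open import Data.Vec using (Vec; []; _∷_)
import Data.Vec as Vec
open import Data.Vec.Relation.Binary.Pointwise.Inductive using (Pointwise; decidable)
open import Data.Product using (_×_; _,_; proj₁; proj₂)
open import Data.Sum using (_⊎_)
open import Relation.Nullary using (¬_; Dec; yes; no)
open import Relation.Binary.PropositionalEquality using (_≡_; _≢_; refl)

data D : Set where
  eps  : D
  b0   : D → D
  b1   : D → D
  star : D

G : D → ℕ
G eps = 1
G star = 1
G (b0 v) = suc (G v)
G (b1 v) = suc (G v)

GV : ∀ {n} → Vec D n → ℕ
GV = Vec.foldr _ (λ v m → G v ⊔ m) 0

data _⊑_ : D → D → Set where
  *⊑ : ∀ {v} → star ⊑ v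
  ε⊑ : eps ⊑ eps
  0⊑ : ∀ {v w} → v ⊑ w → b0 v ⊑ b0 w
  1⊑ : ∀ {v w} → v ⊑ w → b1 v ⊑ b1 w

_⊑?_ : (v w : D) → Dec (v ⊑ w)
star ⊑? w = yes *⊑
eps ⊑? eps = yes ε⊑
eps ⊑? b0 w = no λ ()
eps ⊑? b1 w = no λ ()
eps ⊑? star = no λ ()
b0 v ⊑? eps = no λ ()
b0 v ⊑? b0 w with v ⊑? w
... | yes p = yes (0⊑ p)
... | no ¬p = no λ { (0⊑ p) → ¬p p }
b0 v ⊑? b1 w = no λ ()
b0 v ⊑? star = no λ ()
b1 v ⊑? eps = no λ ()
b1 v ⊑? b0 w = no λ ()
b1 v ⊑? b1 w with v ⊑? w
... | yes p = yes (1⊑ p)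
... | no ¬p = no λ { (1⊑ p) → ¬p p }
b1 v ⊑? star = no λ ()

_⊑V_ : ∀ {n} → Vec D n → Vec D n → Set
_⊑V_ = Pointwise _⊑_

_⊑V?_ : ∀ {n} (xs ys : Vec D n) → Dec (xs ⊑V ys)
_⊑V?_ = decidable _⊑?_

Compat : D → D → Set
Compat v w = v ⊑ w ⊎ w ⊑ v

CompatV : ∀ {n} → Vec D n → Vec D n → Set
CompatV = Pointwise Compat

-- join of two elements; on compatible elements it is their ⊑-maximum
join : D → D → D
join star w = w
join v star = v
join eps eps = eps
join (b0 v) (b0 w) = b0 (join v w)
join (b1 v) (b1 w) = b1 (join v w)
join v w = v   -- incompatible pairs: never used on pairwise compatible sets

max⊑ : List D → D
max⊑ = foldr join star

maxℕ : List ℕ → ℕ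
maxℕ = foldr _⊔_ 0

record Cons (n : ℕ) : Set where
  field
    gens       : List (Vec D n × D)
    nonstar    : All (λ g → proj₂ g ≢ star) gens
    consistent : ∀ {g h} → g ∈ gens → h ∈ gens →
                 CompatV (proj₁ g) (proj₁ h) → Compat (proj₂ g) (proj₂ h)
open Cons public

applyC : ∀ {n} → Cons n → Vec D n → D
applyC c xs = max⊑ (map proj₂ (filter (λ g → proj₁ g ⊑V? xs) (gens c)))

gaugeC : ∀ {n} → Cons n → ℕ
gaugeC c = maxℕ (map (λ g → GV (proj₁ g) ⊔ G (proj₂ g)) (gens c))

data Sym (Fn : Set) : Set where
  sε s0 s1 : Sym Fn
  fn : Fn → Sym Fn

module _ {Fn : Set} (ar : Fn → ℕ) where

  arity : Sym Fn → ℕ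
  arity sε = 0
  arity s0 = 1
  arity s1 = 1
  arity (fn f) = ar f

  data Term : Set where
    var : ℕ → Term
    app : (s : Sym Fn) → Vec Term (arity s) → Term

  mutual
    lh : Term → ℕ
    lh (var x) = 1
    lh (app s ts) = lhV ts + 1

    lhV : ∀ {n} → Vec Term n → ℕ
    lhV [] = 0
    lhV (t ∷ ts) = lh t + lhV ts

  -- a frame: finite partial map from Fn (= 𝓕 ∖ 𝓑) to consistent sets;
  -- domain = dom, and F(f) = ∅ outside the domain
  record Frame : Set where
    field
      fun     : (f : Fn) → Cons (ar f)
      dom     : List Fn
      outside : ∀ f → ¬ (f ∈ dom) → gens (fun f) ≡ []

  GF : Frame → ℕ
  GF F = maxℕ (map (λ f → gaugeC (Frame.fun F f)) (Frame.dom F))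

  appF : Frame → (s : Sym Fn) → Vec D (arity s) → D
  appF F sε [] = eps
  appF F s0 (v ∷ []) = b0 v
  appF F s1 (v ∷ []) = b1 v
  appF F (fn f) xs = applyC (Frame.fun F f) xs

record Assignment : Set where
  field
    fun     : ℕ → D
    dom     : List ℕ
    outside : ∀ x → ¬ (x ∈ dom) → fun x ≡ star

Gρ : Assignment → ℕ
Gρ ρ = maxℕ (map (λ x → G (Assignment.fun ρ x)) (Assignment.dom ρ))

module _ {Fn : Set} (ar : Fn → ℕ) (F : Frame ar) (ρ : Assignment) where
  mutual
    eval : Term ar → D
    eval (var x) = Assignment.fun ρ x
    eval (app s ts) = appF ar F s (evalV ts)

    evalV : ∀ {n} → Vec (Term ar) n → Vec D n
    evalV [] = []
    evalV (t ∷ ts) = eval t ∷ evalV ts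

{-# OPTIONS --safe #-}
module Submission where

-- The gauge grows by one exactly at an application of s₀ or s₁. A symbol of the
-- frame returns the ⊑-maximum of some values of its consistent set, and joins of
-- compatible elements never exceed the larger gauge, so such an application is
-- bounded by G(F) regardless of its arguments; variables are bounded by G(ρ),
-- except * which has gauge 1.

open import Defs
open import Data.Nat using (ℕ; _≤_; _+_; _⊔_; suc; z≤n; s≤s; _≤?_)
open import Data.Nat.Properties
open import Data.List using ([]; _∷_)
open import Data.List.Relation.Unary.All as All using (All; []; _∷_)
import Data.List.Relation.Unary.All.Properties as All
open import Data.List.Membership.Propositional using (_∈_)
open import Data.List.Membership.DecPropositional _≟_ using (_∈?_)
open import Data.Vec using ([]; _∷_)
open import Data.Product using (proj₁; proj₂)
open import Relation.Nullary using (¬_; yes; no)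
open import Relation.Nullary.Decidable using (decidable-stable)
open import Relation.Binary.PropositionalEquality using (_≡_; refl; sym; trans; cong; subst)

G-join : ∀ v w → G (join v w) ≤ G v ⊔ G w
G-join star   w      = m≤n⊔m 1 (G w)
G-join eps    eps    = ≤-refl
G-join (b0 v) (b0 w) = s≤s (G-join v w)
G-join (b1 v) (b1 w) = s≤s (G-join v w)
G-join eps    star   = m≤m⊔n (G eps) 1
G-join (b0 v) star   = m≤m⊔n (G (b0 v)) 1
G-join (b1 v) star   = m≤m⊔n (G (b1 v)) 1
G-join eps    (b0 w) = m≤m⊔n (G eps) (G (b0 w))
G-join eps    (b1 w) = m≤m⊔n (G eps) (G (b1 w))
G-join (b0 v) eps    = m≤m⊔n (G (b0 v)) (G eps)
G-join (b0 v) (b1 w) = m≤m⊔n (G (b0 v)) (G (b1 w))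
G-join (b1 v) eps    = m≤m⊔n (G (b1 v)) (G eps)
G-join (b1 v) (b0 w) = m≤m⊔n (G (b1 v)) (G (b0 w))

G-max⊑≤ : ∀ {B} vs → 1 ≤ B → All (λ v → G v ≤ B) vs → G (max⊑ vs) ≤ B
G-max⊑≤ []       1≤B []         = 1≤B
G-max⊑≤ (v ∷ vs) 1≤B (v≤B ∷ vs≤B) =
  ≤-trans (G-join v (max⊑ vs)) (⊔-lub v≤B (G-max⊑≤ vs 1≤B vs≤B))

xs≤maxℕ : ∀ ns → All (_≤ maxℕ ns) ns
xs≤maxℕ []       = []
xs≤maxℕ (n ∷ ns) = m≤m⊔n n _ ∷ All.map (λ m≤ → ≤-trans m≤ (m≤n⊔m n _)) (xs≤maxℕ ns)

gaugeC-[] : ∀ {n} (c : Cons n) → gens c ≡ [] → gaugeC c ≡ 0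
gaugeC-[] c eq rewrite eq = refl

G-values≤gaugeC : ∀ {n} (c : Cons n) → All (λ g → G (proj₂ g) ≤ gaugeC c) (gens c)
G-values≤gaugeC c =
  All.map (λ {g} ≤gauge → ≤-trans (m≤n⊔m (GV (proj₁ g)) _) ≤gauge)
          (All.map⁻ (xs≤maxℕ _))

G-applyC≤ : ∀ {n B} (c : Cons n) xs → 1 ≤ B → gaugeC c ≤ B → G (applyC c xs) ≤ B
G-applyC≤ c xs 1≤B gauge≤B =
  G-max⊑≤ _ 1≤B (All.map⁺ (All.filter⁺ _
    (All.map (λ ≤gauge → ≤-trans ≤gauge gauge≤B) (G-values≤gaugeC c))))

G-fun≤Gρ+1 : ∀ ρ x → G (Assignment.fun ρ x) ≤ Gρ ρ + 1
G-fun≤Gρ+1 ρ x with x ∈? Assignment.dom ρ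
... | yes x∈dom = ≤-trans (All.lookup (All.map⁻ (xs≤maxℕ _)) x∈dom) (m≤m+n (Gρ ρ) 1)
... | no  x∉dom = subst (λ v → G v ≤ Gρ ρ + 1) (sym (Assignment.outside ρ x x∉dom)) (m≤n+m 1 (Gρ ρ))

-- Membership in dom F need not be decidable (Fn has no decidable equality), but
-- the conclusion is a decidable, hence stable, proposition.
gaugeC≤GF : ∀ {Fn : Set} (ar : Fn → ℕ) (F : Frame ar) f → gaugeC (Frame.fun F f) ≤ GF ar F
gaugeC≤GF ar F f = decidable-stable (_ ≤? _) λ ≰ → ≰ (outside λ f∈dom → ≰ (inside f∈dom))
  where
  inside : f ∈ Frame.dom F → gaugeC (Frame.fun F f) ≤ GF ar F
  inside = All.lookup (All.map⁻ (xs≤maxℕ _))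

  outside : ¬ f ∈ Frame.dom F → gaugeC (Frame.fun F f) ≤ GF ar F
  outside f∉dom rewrite gaugeC-[] (Frame.fun F f) (Frame.outside F f f∉dom) = z≤n

m+[n+0+1]≡1+m+n : ∀ m n → m + (n + 0 + 1) ≡ suc (m + n)
m+[n+0+1]≡1+m+n m n = trans (cong (m +_) (trans (cong (_+ 1) (+-identityʳ n)) (+-comm n 1))) (+-suc m n)

module _ {Fn : Set} (ar : Fn → ℕ) (ρ : Assignment) (F : Frame ar) where

  private
    M : ℕ
    M = Gρ ρ ⊔ GF ar F

  G-eval≤ : ∀ t → G (eval ar F ρ t) ≤ M + lh ar t
  G-bit≤ : ∀ t → suc (G (eval ar F ρ t)) ≤ M + (lh ar t + 0 + 1)

  G-eval≤ (var x)           = ≤-trans (G-fun≤Gρ+1 ρ x) (+-monoˡ-≤ 1 (m≤m⊔n (Gρ ρ) (GF ar F)))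
  G-eval≤ (app sε [])       = m≤n+m 1 M
  G-eval≤ (app s0 (t ∷ [])) = G-bit≤ t
  G-eval≤ (app s1 (t ∷ [])) = G-bit≤ t
  G-eval≤ (app (fn f) ts)   =
    G-applyC≤ (Frame.fun F f) _ (≤-trans (m≤n+m 1 (lhV ar ts)) (m≤n+m _ M))
              (≤-trans (gaugeC≤GF ar F f) (≤-trans (m≤n⊔m (Gρ ρ) _) (m≤m+n M _)))

  G-bit≤ t = ≤-trans (s≤s (G-eval≤ t)) (≤-reflexive (sym (m+[n+0+1]≡1+m+n M (lh ar t))))

lemma4p23 : {Fn : Set} (ar : Fn → ℕ) (ρ : Assignment) (F : Frame ar) (t : Term ar) →
    G (eval ar F ρ t) ≤ (Gρ ρ ⊔ GF ar F) + lh ar t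
lemma4p23 = G-eval≤
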